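{- Let $\mathbf{U}=(\mathbf{T},G,H)$ be an $\mathrm{itKI}_{c1}$-algebra and let $D$ be a centered tense deductive system of $\mathbf{U}$. Then $D_{S_D}=D$, where $S_D=D\cap C(T)$ and, for $S\subseteq C(T)$, $D_S=\{u\in T:\ \sim u\Rightarrow c\in S\text{ and }1\Rightarrow(u\vee c)\in S\}$.
   Context: A centered Kleene algebra is $\langle T,\wedge,\vee,\sim,c,0,1\rangle$ with bounded distributive lattice reduct, $\sim\sim x=x$, $\sim(x\vee y)=\sim x\wedge\sim y$, $x\wedge\sim x\le y\vee\sim y$, $\sim c=c$. A KI-algebra is $\langle T,\wedge,\vee,\Rightarrow,\sim,c,0,1\rangle$ with centered Kleene reduct such that: $(a\Rightarrow b)\wedge(a\Rightarrow d)=a\Rightarrow(b\wedge d)$, $(a\Rightarrow d)\wedge(b\Rightarrow d)=(a\vee b)\Rightarrow d$, $0\Rightarrow a=1$, $a\Rightarrow 1=1$; $(x\wedge(x\Rightarrow y))\vee c\le y\vee c$; $c\Rightarrow c=1$; $(x\Rightarrow y)\wedge c=(\sim x\vee y)\wedge c$; $(x\Rightarrow\sim y)\vee c=(x\Rightarrow(\sim y\vee c))\wedge(y\Rightarrow(\sim x\vee c))$. A tense centered KI-algebra is $(\mathbf{T},G,H)$ with $F(x):=\sim G(\sim x)$, $P(x):=\sim H(\sim x)$, satisfying $G(1)=H(1)=1$; $G,H$ preserve $\wedge$; $x\le GP(x)$, $x\le HF(x)$; $G(x\vee y)\le G(x)\vee F(y)$, $H(x\vee y)\le H(x)\vee P(y)$;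 $G(x\Rightarrow y)\le G(x)\Rightarrow G(y)$, $H(x\Rightarrow y)\le H(x)\Rightarrow H(y)$; $G(x\Rightarrow y)\le F(x)\Rightarrow F(y)$, $H(x\Rightarrow y)\le P(x)\Rightarrow P(y)$; $G(c)=c=H(c)$. An $\mathrm{itKI}_{c1}$-algebra is a tense centered KI-algebra satisfying $x\Rightarrow x=1$ and (CK): for all $x,y\ge c$ with $x\wedge y\le c$ there is $z$ with $z\vee c=x$ and $\sim z\vee c=y$. $C(T)=\{x\in T:x\ge c\}$ with restricted operations. A tense 1-filter of $C(T)$ is a lattice filter $S$ of $C(T)$ with $((a\wedge f)\Rightarrow b)\Rightarrow(a\Rightarrow b)\in S$ for all $a,b\in C(T)$, $f\in S$, closed under $G,H$. A tense deductive system of $\mathbf{U}$ is $D\subseteq T$ with $1\in D$; $u,u\Rightarrow v\in D$ implies $v\in D$; $u\in D$ implies $G(u),H(u)\in D$. It is centered if $D\cap C(T)$ is a tense 1-filter of $C(T)$ and for every $u\in T$, $\sim u\Rightarrow c\in D$ and $1\Rightarrow(u\vee c)\in D$ imply $u\in D$. -}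

module Defs where

open import Level using (Level; _⊔_; suc)
open import Data.Product using (Σ; ∃; _×_; _,_)
open import Relation.Binary.PropositionalEquality using (_≡_)

-- An itKI_c1-algebra (tense centered KI-algebra with x ⇒ x = 1 and (CK)),
-- with equality taken to be propositional equality on the carrier.
record ItKIc1 (a : Level) : Set (suc a) where
  infixr 6 _∨_
  infixr 7 _∧_
  infixr 5 _⇒_
  infix 4 _≤_
  field
    T   : Set a
    _∧_ _∨_ _⇒_ : T → T → T
    ∼   : T → T
    c 0# 1# : T
    G H : T → T

  _≤_ : T → T → Set a
  x ≤ y = x ∧ y ≡ x

  F : T → T
  F x = ∼ (G (∼ x))

  P : T → T
  P x = ∼ (H (∼ x))

  field
    ∧-assoc : ∀ x y z → (x ∧ y) ∧ z ≡ x ∧ (y ∧ z)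
    ∨-assoc : ∀ x y z → (x ∨ y) ∨ z ≡ x ∨ (y ∨ z)
    ∧-comm  : ∀ x y → x ∧ y ≡ y ∧ x
    ∨-comm  : ∀ x y → x ∨ y ≡ y ∨ x
    ∧-absorb : ∀ x y → x ∧ (x ∨ y) ≡ x
    ∨-absorb : ∀ x y → x ∨ (x ∧ y) ≡ x
    ∧-distrib-∨ : ∀ x y z → x ∧ (y ∨ z) ≡ (x ∧ y) ∨ (x ∧ z)
    0-least : ∀ x → 0# ≤ x
    1-greatest : ∀ x → x ≤ 1#
    ∼-invol : ∀ x → ∼ (∼ x) ≡ x
    ∼-deMorgan : ∀ x y → ∼ (x ∨ y) ≡ ∼ x ∧ ∼ y
    kleene : ∀ x y → x ∧ ∼ x ≤ y ∨ ∼ y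
    ∼c : ∼ c ≡ c
    ⇒-∧ : ∀ a b d → (a ⇒ b) ∧ (a ⇒ d) ≡ a ⇒ (b ∧ d)
    ⇒-∨ : ∀ a b d → (a ⇒ d) ∧ (b ⇒ d) ≡ (a ∨ b) ⇒ d
    0⇒ : ∀ a → 0# ⇒ a ≡ 1#
    ⇒1 : ∀ a → a ⇒ 1# ≡ 1#
    mp-c : ∀ x y → (x ∧ (x ⇒ y)) ∨ c ≤ y ∨ c
    c⇒c : c ⇒ c ≡ 1#
    ⇒-c : ∀ x y → (x ⇒ y) ∧ c ≡ (∼ x ∨ y) ∧ c
    ⇒-∼ : ∀ x y → (x ⇒ ∼ y) ∨ c ≡ (x ⇒ (∼ y ∨ c)) ∧ (y ⇒ (∼ x ∨ c))
    G1 : G 1# ≡ 1#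
    H1 : H 1# ≡ 1#
    G-∧ : ∀ x y → G (x ∧ y) ≡ G x ∧ G y
    H-∧ : ∀ x y → H (x ∧ y) ≡ H x ∧ H y
    x≤GP : ∀ x → x ≤ G (P x)
    x≤HF : ∀ x → x ≤ H (F x)
    G-∨ : ∀ x y → G (x ∨ y) ≤ G x ∨ F y
    H-∨ : ∀ x y → H (x ∨ y) ≤ H x ∨ P y
    G-⇒ : ∀ x y → G (x ⇒ y) ≤ G x ⇒ G y
    H-⇒ : ∀ x y → H (x ⇒ y) ≤ H x ⇒ H y
    G-⇒F : ∀ x y → G (x ⇒ y) ≤ F x ⇒ F y
    H-⇒P : ∀ x y → H (x ⇒ y) ≤ P x ⇒ P y
    Gc : G c ≡ c
    Hc : H c ≡ c
    ⇒-refl : ∀ x → x ⇒ x ≡ 1#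
    CK : ∀ x y → c ≤ x → c ≤ y → x ∧ y ≤ c →
         ∃ λ z → (z ∨ c ≡ x) × (∼ z ∨ c ≡ y)

module _ {a : Level} (U : ItKIc1 a) where
  open ItKIc1 U

  -- Subsets of T are predicates; subsets of C(T) = {x | c ≤ x} are predicates
  -- on T contained in C(T).
  InC : T → Set a
  InC x = c ≤ x

  record IsTense1Filter {p : Level} (S : T → Set p) : Set (a ⊔ p) where
    field
      ⊆C      : ∀ x → S x → InC x
      has1    : S 1#
      up      : ∀ x y → S x → InC y → x ≤ y → S y
      ∧-close : ∀ x y → S x → S y → S (x ∧ y)
      cond    : ∀ a b f → InC a → InC b → S f → S (((a ∧ f) ⇒ b) ⇒ (a ⇒ b))
      G-close : ∀ x → S x → S (G x)
      H-close : ∀ x → S x → S (H x)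

  record IsTenseDS {p : Level} (D : T → Set p) : Set (a ⊔ p) where
    field
      has1 : D 1#
      mp   : ∀ u v → D u → D (u ⇒ v) → D v
      G-close : ∀ u → D u → D (G u)
      H-close : ∀ u → D u → D (H u)

  S[_] : {p : Level} → (T → Set p) → T → Set (a ⊔ p)
  S[ D ] x = D x × InC x

  D[_] : {p : Level} → (T → Set p) → T → Set p
  D[ S ] u = S (∼ u ⇒ c) × S (1# ⇒ (u ∨ c))

  record IsCenteredTenseDS {p : Level} (D : T → Set p) : Set (a ⊔ p) where
    field
      isTDS : IsTenseDS D
      filt  : IsTense1Filter S[ D ]
      recover : ∀ u → D (∼ u ⇒ c) → D (1# ⇒ (u ∨ c)) → D u

-- D ⊆ D_{S_D} is the content; the converse inclusion is the axiom `recover`.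
-- For u ∈ D the element f = u ∨ c lies in S_D, and the 1-filter condition
-- instantiated at f yields a ⇒ b ∈ D whenever (a ∧ f) ⇒ b = 1.  With a = 1,
-- b = f this gives 1 ⇒ (u ∨ c); with a = ∼u ∨ c, b = c it gives
-- (∼u ∨ c) ⇒ c, because (∼u ∨ c) ∧ (u ∨ c) = c in a centered Kleene algebra,
-- and ∼u ⇒ c lies above it as ⇒ is antitone in its first argument.

module Submission where

open import Defs
open import Level using (Level)
open import Data.Product using (_×_; _,_; proj₁)
open import Relation.Binary.PropositionalEquality

module Properties {a : Level} (U : ItKIc1 a) where
  open ItKIc1 U
  open ≡-Reasoning

  ∨-idem : ∀ x → x ∨ x ≡ x
  ∨-idem x = trans (cong (x ∨_) (sym (∧-absorb x x))) (∨-absorb x (x ∨ x))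

  ≤-refl : ∀ x → x ≤ x
  ≤-refl x = trans (cong (x ∧_) (sym (∨-absorb x x))) (∧-absorb x (x ∧ x))

  x≤x∨y : ∀ x y → x ≤ x ∨ y
  x≤x∨y = ∧-absorb

  x≤y⇒x∨y≡y : ∀ {x y} → x ≤ y → x ∨ y ≡ y
  x≤y⇒x∨y≡y {x} {y} x≤y = begin
    x ∨ y        ≡⟨ cong (_∨ y) (sym x≤y) ⟩
    (x ∧ y) ∨ y  ≡⟨ ∨-comm _ _ ⟩
    y ∨ (x ∧ y)  ≡⟨ cong (y ∨_) (∧-comm x y) ⟩
    y ∨ (y ∧ x)  ≡⟨ ∨-absorb y x ⟩
    y            ∎

  x≤y⇒x≤z∨y : ∀ {x y} z → x ≤ y → x ≤ z ∨ y
  x≤y⇒x≤z∨y {x} {y} z x≤y = begin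
    x ∧ (z ∨ y)        ≡⟨ ∧-distrib-∨ x z y ⟩
    (x ∧ z) ∨ (x ∧ y)  ≡⟨ cong ((x ∧ z) ∨_) x≤y ⟩
    (x ∧ z) ∨ x        ≡⟨ ∨-comm _ _ ⟩
    x ∨ (x ∧ z)        ≡⟨ ∨-absorb x z ⟩
    x                  ∎

  c≤x∨c : ∀ x → c ≤ x ∨ c
  c≤x∨c x = x≤y⇒x≤z∨y x (≤-refl c)

  x∧∼x≤c : ∀ x → x ∧ ∼ x ≤ c
  x∧∼x≤c x = subst (x ∧ ∼ x ≤_) (trans (cong (c ∨_) ∼c) (∨-idem c)) (kleene x c)

  ∼x∨c∧x∨c≡c : ∀ x → (∼ x ∨ c) ∧ (x ∨ c) ≡ c
  ∼x∨c∧x∨c≡c x = begin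
    (∼ x ∨ c) ∧ (x ∨ c)                ≡⟨ ∧-distrib-∨ _ x c ⟩
    ((∼ x ∨ c) ∧ x) ∨ ((∼ x ∨ c) ∧ c)  ≡⟨ cong₂ _∨_ (∧-comm _ x) (trans (∧-comm _ c) (c≤x∨c (∼ x))) ⟩
    (x ∧ (∼ x ∨ c)) ∨ c                ≡⟨ cong (_∨ c) (∧-distrib-∨ x (∼ x) c) ⟩
    ((x ∧ ∼ x) ∨ (x ∧ c)) ∨ c          ≡⟨ ∨-assoc _ _ c ⟩
    (x ∧ ∼ x) ∨ ((x ∧ c) ∨ c)          ≡⟨ cong ((x ∧ ∼ x) ∨_) x∧c∨c≡c ⟩
    (x ∧ ∼ x) ∨ c                      ≡⟨ x≤y⇒x∨y≡y (x∧∼x≤c x) ⟩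
    c                                  ∎
    where
    x∧c∨c≡c : (x ∧ c) ∨ c ≡ c
    x∧c∨c≡c = x≤y⇒x∨y≡y (trans (∧-assoc x c c) (cong (x ∧_) (≤-refl c)))

  x≤y⇒x⇒y≡1 : ∀ {x y} → x ≤ y → x ⇒ y ≡ 1#
  x≤y⇒x⇒y≡1 {x} {y} x≤y = begin
    x ⇒ y              ≡⟨ sym (1-greatest _) ⟩
    (x ⇒ y) ∧ 1#       ≡⟨ ∧-comm _ _ ⟩
    1# ∧ (x ⇒ y)       ≡⟨ cong (_∧ (x ⇒ y)) (sym (⇒-refl x)) ⟩
    (x ⇒ x) ∧ (x ⇒ y)  ≡⟨ ⇒-∧ x x y ⟩
    x ⇒ (x ∧ y)        ≡⟨ cong (x ⇒_) x≤y ⟩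
    x ⇒ x              ≡⟨ ⇒-refl x ⟩
    1#                 ∎

  ⇒-antitoneˡ : ∀ {x y} z → x ≤ y → y ⇒ z ≤ x ⇒ z
  ⇒-antitoneˡ {x} {y} z x≤y =
    trans (∧-comm _ _) (trans (⇒-∨ x y z) (cong (_⇒ z) (x≤y⇒x∨y≡y x≤y)))

  c≤y⇒c≤x⇒y : ∀ x {y} → c ≤ y → c ≤ x ⇒ y
  c≤y⇒c≤x⇒y x {y} c≤y = begin
    c ∧ (x ⇒ y)    ≡⟨ ∧-comm _ _ ⟩
    (x ⇒ y) ∧ c    ≡⟨ ⇒-c x y ⟩
    (∼ x ∨ y) ∧ c  ≡⟨ ∧-comm _ _ ⟩
    c ∧ (∼ x ∨ y)  ≡⟨ x≤y⇒x≤z∨y (∼ x) c≤y ⟩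
    c              ∎

module TenseDS {a p : Level} (U : ItKIc1 a) {D : ItKIc1.T U → Set p}
               (isTDS : IsTenseDS U D) where
  open ItKIc1 U
  open IsTenseDS isTDS
  open Properties U

  ≤-closed : ∀ {x y} → D x → x ≤ y → D y
  ≤-closed {x} {y} x∈D x≤y = mp x y x∈D (subst D (sym (x≤y⇒x⇒y≡1 x≤y)) has1)

  1⇒-elim : ∀ {x} → D (1# ⇒ x) → D x
  1⇒-elim = mp 1# _ has1

module CenteredTenseDS {a p : Level} (U : ItKIc1 a) {D : ItKIc1.T U → Set p}
                       (cD : IsCenteredTenseDS U D) where
  open ItKIc1 U
  open IsCenteredTenseDS cD
  open Properties U
  open TenseDS U isTDS
  module S = IsTense1Filter filt

  ⇒-intro : ∀ {x y f} → InC U x → InC U y → S[_] U D f →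
            (x ∧ f) ⇒ y ≡ 1# → D (x ⇒ y)
  ⇒-intro {x} {y} {f} x∈C y∈C f∈S x∧f⇒y≡1 =
    1⇒-elim (subst (λ t → D (t ⇒ (x ⇒ y))) x∧f⇒y≡1 (proj₁ (S.cond x y f x∈C y∈C f∈S)))

  ∨c-∈S : ∀ {u} → D u → S[_] U D (u ∨ c)
  ∨c-∈S {u} u∈D = ≤-closed u∈D (x≤x∨y u c) , c≤x∨c u

  1⇒∨c-∈D : ∀ {u} → D u → D (1# ⇒ (u ∨ c))
  1⇒∨c-∈D {u} u∈D = ⇒-intro (1-greatest c) (c≤x∨c u) (∨c-∈S u∈D)
    (x≤y⇒x⇒y≡1 (trans (∧-assoc 1# _ _) (cong (1# ∧_) (≤-refl (u ∨ c)))))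

  ∼⇒c-∈D : ∀ {u} → D u → D (∼ u ⇒ c)
  ∼⇒c-∈D {u} u∈D = ≤-closed ∼u∨c⇒c∈D (⇒-antitoneˡ c (x≤x∨y (∼ u) c))
    where
    ∼u∨c⇒c∈D : D ((∼ u ∨ c) ⇒ c)
    ∼u∨c⇒c∈D = ⇒-intro (c≤x∨c (∼ u)) (≤-refl c) (∨c-∈S u∈D)
      (trans (cong (_⇒ c) (∼x∨c∧x∨c≡c u)) c⇒c)

lemma7p11 : {a p : Level} (U : ItKIc1 a) (D : ItKIc1.T U → Set p) →
            IsCenteredTenseDS U D →
            (∀ u → (D[_] U (S[_] U D) u → D u) × (D u → D[_] U (S[_] U D) u))
lemma7p11 U D cD u =
    (λ { ((∼u⇒c∈D , _) , (1⇒u∨c∈D , _)) → recover u ∼u⇒c∈D 1⇒u∨c∈D })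
  , (λ u∈D → (∼⇒c-∈D u∈D , c≤y⇒c≤x⇒y (∼ u) (≤-refl c))
           , (1⇒∨c-∈D u∈D , c≤y⇒c≤x⇒y 1# (c≤x∨c u)))
  where
  open ItKIc1 U
  open IsCenteredTenseDS cD
  open Properties U
  open CenteredTenseDS U cD
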